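{- Let $\mathcal F=\{\langle A,F\rangle: A\in\mathbf S,\ F\text{ a lattice filter of }A\}$ and $\mathcal F_g=\{\langle A,\mathcal{F}i(A)\rangle: A\in\mathbf S\}$, where $\mathcal{F}i(A)$ is the set of all lattice filters of $A$. Then the logic $\mathbf{Six}$ coincides with the logic determined by the family of matrices $\mathcal F$ and with the logic determined by the family of generalized matrices $\mathcal F_g$.
   Context: An involutive Stone algebra is a De Morgan algebra (bounded distributive lattice with $\neg\neg x=x$, $\neg(x\wedge y)=\neg x\vee\neg y$) with a unary $\nabla$ satisfying $\nabla0=0$, $a\wedge\nabla a=a$, $\nabla(a\wedge b)=\nabla a\wedge\nabla b$, $\neg\nabla a\wedge\nabla a=0$; the class is $\mathbf S$. $Fm$ is the set of formulas over a denumerable set of propositional variables built from binary $\wedge,\vee$, unary $\neg,\nabla$ and constants $\bot,\top$; homomorphisms send $\bot\mapsto0,\top\mapsto1$. The logic $\mathbf{Six}$: for nonempty finite $\{\alpha_1,\dots,\alpha_n\}$, $\alpha_1,\dots,\alpha_n\models_{\mathbf{Six}}\alpha$ iff for every $A\in\mathbf S$, every homomorphism $v:\mathfrak{Fm}\to A$ and every $a\in A$, if $v(\alpha_i)\ge a$ for all $i$ then $v(\alpha)\ge a$; $\emptyset\models_{\mathbf{Six}}\alpha$ iff $v(\alpha)=1$ for all $A,v$; for infinite $\Gamma$, $\Gamma\models_{\mathbf{Six}}\alpha$ iff some finite nonempty subset of $\Gamma$ entails $\alpha$. A lattice filter of $A$ is $F\subseteq A$ with $1\in F$, upward closed and closed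 under $\wedge$. For a matrix $\langle A,F\rangle$: $\Gamma\models_{\langle A,F\rangle}\alpha$ iff every homomorphism $v$ with $v(\Gamma)\subseteq F$ has $v(\alpha)\in F$. For a generalized matrix $\langle A,\mathcal C\rangle$ ($\mathcal C$ a family of subsets of $A$): $\Gamma\models_{\langle A,\mathcal C\rangle}\alpha$ iff for every homomorphism $v$ and every $F\in\mathcal C$, $v(\Gamma)\subseteq F$ implies $v(\alpha)\in F$. The logic of a family of (generalized) matrices is the intersection of their consequence relations. -}

module Defs where

open import Data.Nat using (ℕ)
open import Data.Product using (Σ; ∃; ∃-syntax; _×_; _,_)
open import Data.List using (List; []; _∷_)
open import Data.List.Relation.Unary.All using (All)
open import Relation.Binary.Structures using (IsEquivalence)

infixr 6 _∧_
infixr 5 _∨_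

-- Involutive Stone algebras, as setoid-based algebras (carrier, equality ≈,
-- operations congruent w.r.t. ≈), following the stdlib Algebra conventions.
record ISA : Set₁ where
  infix  4 _≈_
  infixr 6 _⊓_
  infixr 5 _⊔_
  field
    Carrier : Set
    _≈_     : Carrier → Carrier → Set
    isEquivalence : IsEquivalence _≈_
    _⊓_ _⊔_ : Carrier → Carrier → Carrier
    ¬_ ∇_   : Carrier → Carrier
    𝟘 𝟙     : Carrier
    ⊓-cong : ∀ {a a′ b b′} → a ≈ a′ → b ≈ b′ → (a ⊓ b) ≈ (a′ ⊓ b′)
    ⊔-cong : ∀ {a a′ b b′} → a ≈ a′ → b ≈ b′ → (a ⊔ b) ≈ (a′ ⊔ b′)
    ¬-cong : ∀ {a a′} → a ≈ a′ → (¬ a) ≈ (¬ a′)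
    ∇-cong : ∀ {a a′} → a ≈ a′ → (∇ a) ≈ (∇ a′)
    ⊓-comm  : ∀ a b → (a ⊓ b) ≈ (b ⊓ a)
    ⊔-comm  : ∀ a b → (a ⊔ b) ≈ (b ⊔ a)
    ⊓-assoc : ∀ a b c → ((a ⊓ b) ⊓ c) ≈ (a ⊓ (b ⊓ c))
    ⊔-assoc : ∀ a b c → ((a ⊔ b) ⊔ c) ≈ (a ⊔ (b ⊔ c))
    ⊓-absorbs-⊔ : ∀ a b → (a ⊓ (a ⊔ b)) ≈ a
    ⊔-absorbs-⊓ : ∀ a b → (a ⊔ (a ⊓ b)) ≈ a
    ⊓-distrib-⊔ : ∀ a b c → (a ⊓ (b ⊔ c)) ≈ ((a ⊓ b) ⊔ (a ⊓ c))
    ⊓-identity : ∀ a → (a ⊓ 𝟙) ≈ a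
    ⊔-identity : ∀ a → (a ⊔ 𝟘) ≈ a
    ¬¬ : ∀ a → (¬ (¬ a)) ≈ a
    ¬-⊓ : ∀ a b → (¬ (a ⊓ b)) ≈ ((¬ a) ⊔ (¬ b))
    ∇𝟘 : (∇ 𝟘) ≈ 𝟘
    ∇-infl : ∀ a → (a ⊓ (∇ a)) ≈ a
    ∇-⊓ : ∀ a b → (∇ (a ⊓ b)) ≈ ((∇ a) ⊓ (∇ b))
    ∇-compl : ∀ a → ((¬ (∇ a)) ⊓ (∇ a)) ≈ 𝟘

  _≤_ : Carrier → Carrier → Set
  a ≤ b = (a ⊓ b) ≈ a

data Fm : Set where
  var     : ℕ → Fm
  _∧_ _∨_ : Fm → Fm → Fm
  ¬′ ∇′   : Fm → Fm
  ⊥′ ⊤′   : Fm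

-- Homomorphisms 𝔉𝔪 → A are exactly the evaluation maps induced by
-- valuations ℕ → Carrier A.
module _ (A : ISA) where
  open ISA A
  ⟦_⟧ : Fm → (ℕ → Carrier) → Carrier
  ⟦ var n ⟧ v = v n
  ⟦ φ ∧ ψ ⟧ v = ⟦ φ ⟧ v ⊓ ⟦ ψ ⟧ v
  ⟦ φ ∨ ψ ⟧ v = ⟦ φ ⟧ v ⊔ ⟦ ψ ⟧ v
  ⟦ ¬′ φ ⟧ v = ¬ (⟦ φ ⟧ v)
  ⟦ ∇′ φ ⟧ v = ∇ (⟦ φ ⟧ v)
  ⟦ ⊥′ ⟧ v = 𝟘
  ⟦ ⊤′ ⟧ v = 𝟙

  record IsLatticeFilter (F : Carrier → Set) : Set where
    field
      has-𝟙  : F 𝟙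
      up     : ∀ {a b} → a ≤ b → F a → F b
      meet   : ∀ {a b} → F a → F b → F (a ⊓ b)

FmSet : Set₁
FmSet = Fm → Set

SixFin : List Fm → Fm → Set₁
SixFin [] α = (A : ISA) → (v : ℕ → ISA.Carrier A) →
  ISA._≈_ A (⟦ A ⟧ α v) (ISA.𝟙 A)
SixFin (γ ∷ Δ) α = (A : ISA) → (v : ℕ → ISA.Carrier A) → (a : ISA.Carrier A) →
  All (λ δ → ISA._≤_ A a (⟦ A ⟧ δ v)) (γ ∷ Δ) → ISA._≤_ A a (⟦ A ⟧ α v)

Six : FmSet → Fm → Set₁
Six Γ α = Σ (List Fm) λ Δ → All Γ Δ × SixFin Δ α

MatrixLogic : FmSet → Fm → Set₁
MatrixLogic Γ α = (A : ISA) → (F : ISA.Carrier A → Set) → IsLatticeFilter A F →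
  (v : ℕ → ISA.Carrier A) → (∀ γ → Γ γ → F (⟦ A ⟧ γ v)) → F (⟦ A ⟧ α v)

-- Logic of the family of generalized matrices ⟨A, Fi(A)⟩, A ∈ S.
-- Fi(A) = { F | IsLatticeFilter A F }.
GenMatrixLogic : FmSet → Fm → Set₁
GenMatrixLogic Γ α = (A : ISA) → (v : ℕ → ISA.Carrier A) →
  (F : ISA.Carrier A → Set) → IsLatticeFilter A F →
  (∀ γ → Γ γ → F (⟦ A ⟧ γ v)) → F (⟦ A ⟧ α v)

{-# OPTIONS --safe #-}
module Submission where

-- Taking the empty meet to be ⊤, both clauses of Six say that ⋀Δ ≤ α holds
-- in every algebra for some finite Δ ⊆ Γ. Soundness: ⋀Δ lies in every filter
-- containing the premises, and filters are upward closed. Completeness: in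
-- the Lindenbaum algebra of formulas the filter generated by Γ consists of the
-- formulas above some ⋀Δ with Δ ⊆ Γ; evaluating each variable as itself turns
-- the matrix consequence into such an inequality, which then holds in every
-- involutive Stone algebra. The generalized matrices differ from the matrices
-- only in the order of quantifiers.

open import Defs
open import Algebra.Lattice.Bundles using (Lattice)
import Algebra.Lattice.Properties.Lattice as LatticeProperties
open import Data.List using (List; []; _∷_; _++_)
open import Data.List.Relation.Unary.All using (All; []; _∷_)
import Data.List.Relation.Unary.All as All
open import Data.List.Relation.Unary.All.Properties using (++⁺)
open import Data.Nat using (ℕ)
open import Data.Product using (_×_; _,_; Σ)
open import Function.Bundles using (_⇔_; mk⇔; module Equivalence)
import Function.Properties.Equivalence as ⇔
open import Relation.Binary.Lattice using (MeetSemilattice)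
import Relation.Binary.Lattice.Properties.MeetSemilattice as MeetSemilatticeProperties
open import Relation.Binary.PropositionalEquality using (_≡_; refl; cong; cong₂; subst)
import Relation.Binary.PropositionalEquality as ≡
open import Relation.Binary.Structures using (IsEquivalence)

module ISAProperties (A : ISA) where
  open ISA A
  open IsEquivalence isEquivalence

  lattice : Lattice _ _
  lattice = record
    { Carrier = Carrier ; _≈_ = _≈_ ; _∨_ = _⊔_ ; _∧_ = _⊓_
    ; isLattice = record
      { isEquivalence = isEquivalence
      ; ∨-comm = ⊔-comm ; ∨-assoc = ⊔-assoc ; ∨-cong = ⊔-cong
      ; ∧-comm = ⊓-comm ; ∧-assoc = ⊓-assoc ; ∧-cong = ⊓-cong
      ; absorptive = ⊔-absorbs-⊓ , ⊓-absorbs-⊔ } }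

  -- The library orders a meet semilattice by a ≈ a ⊓ b, the symmetric form
  -- of ISA._≤_.
  private
    meetSemilattice : MeetSemilattice _ _ _
    meetSemilattice = LatticeProperties.∧-orderTheoreticMeetSemilattice lattice
    module M = MeetSemilattice meetSemilattice

  ≤-reflexive : ∀ {a b} → a ≈ b → a ≤ b
  ≤-reflexive a≈b = sym (M.reflexive a≈b)

  ≤-trans : ∀ {a b c} → a ≤ b → b ≤ c → a ≤ c
  ≤-trans a≤b b≤c = sym (M.trans (sym a≤b) (sym b≤c))

  x⊓y≤x : ∀ a b → (a ⊓ b) ≤ a
  x⊓y≤x a b = sym (M.x∧y≤x a b)

  x⊓y≤y : ∀ a b → (a ⊓ b) ≤ b
  x⊓y≤y a b = sym (M.x∧y≤y a b)

  ⊓-greatest : ∀ {a b c} → a ≤ b → a ≤ c → a ≤ (b ⊓ c)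
  ⊓-greatest a≤b a≤c = sym (M.∧-greatest (sym a≤b) (sym a≤c))

  ⊓-monotonic : ∀ {a b c d} → a ≤ b → c ≤ d → (a ⊓ c) ≤ (b ⊓ d)
  ⊓-monotonic a≤b c≤d =
    sym (MeetSemilatticeProperties.∧-monotonic meetSemilattice (sym a≤b) (sym c≤d))

  x≤𝟙 : ∀ a → a ≤ 𝟙
  x≤𝟙 = ⊓-identity

  𝟙≤x⇔x≈𝟙 : ∀ {a} → 𝟙 ≤ a ⇔ a ≈ 𝟙
  𝟙≤x⇔x≈𝟙 {a} = mk⇔
    (λ 𝟙≤a → trans (sym (⊓-identity a)) (trans (⊓-comm a 𝟙) 𝟙≤a))
    (λ a≈𝟙 → ≤-reflexive (sym a≈𝟙))

⋀ : List Fm → Fm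
⋀ []      = ⊤′
⋀ (γ ∷ Δ) = γ ∧ ⋀ Δ

module _ (A : ISA) (v : ℕ → ISA.Carrier A) where
  open ISA A
  open ISAProperties A

  ⋀-lowerBounds : ∀ Δ → All (λ δ → ⟦ A ⟧ (⋀ Δ) v ≤ ⟦ A ⟧ δ v) Δ
  ⋀-lowerBounds []      = []
  ⋀-lowerBounds (γ ∷ Δ) =
    x⊓y≤x _ _ ∷ All.map (≤-trans (x⊓y≤y _ _)) (⋀-lowerBounds Δ)

  ⋀-greatest : ∀ {a} Δ → All (λ δ → a ≤ ⟦ A ⟧ δ v) Δ → a ≤ ⟦ A ⟧ (⋀ Δ) v
  ⋀-greatest []      []         = x≤𝟙 _
  ⋀-greatest (γ ∷ Δ) (a≤γ ∷ ps) = ⊓-greatest a≤γ (⋀-greatest Δ ps)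

  ⋀-∈-filter : ∀ {F} → IsLatticeFilter A F →
    ∀ Δ → All (λ δ → F (⟦ A ⟧ δ v)) Δ → F (⟦ A ⟧ (⋀ Δ) v)
  ⋀-∈-filter isF []      []         = IsLatticeFilter.has-𝟙 isF
  ⋀-∈-filter isF (γ ∷ Δ) (γ∈F ∷ ps) = IsLatticeFilter.meet isF γ∈F (⋀-∈-filter isF Δ ps)

Valid≤ : Fm → Fm → Set₁
Valid≤ φ ψ = (A : ISA) (v : ℕ → ISA.Carrier A) → ISA._≤_ A (⟦ A ⟧ φ v) (⟦ A ⟧ ψ v)

sixFin⇔valid≤ : ∀ Δ α → SixFin Δ α ⇔ Valid≤ (⋀ Δ) α
sixFin⇔valid≤ [] α = mk⇔
  (λ valid A v → Equivalence.from (ISAProperties.𝟙≤x⇔x≈𝟙 A) (valid A v))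
  (λ 𝟙≤α A v → Equivalence.to (ISAProperties.𝟙≤x⇔x≈𝟙 A) (𝟙≤α A v))
sixFin⇔valid≤ Δ@(_ ∷ _) α = mk⇔
  (λ s A v → s A v (⟦ A ⟧ (⋀ Δ) v) (⋀-lowerBounds A v Δ))
  (λ ⋀Δ≤α A v a a≤Δ → ISAProperties.≤-trans A (⋀-greatest A v Δ a≤Δ) (⋀Δ≤α A v))

six⇒matrix : ∀ Γ α → Six Γ α → MatrixLogic Γ α
six⇒matrix Γ α (Δ , Δ⊆Γ , s) A F isF v Γ⊆F =
  IsLatticeFilter.up isF (Equivalence.to (sixFin⇔valid≤ Δ α) s A v)
    (⋀-∈-filter A v isF Δ (All.map (Γ⊆F _) Δ⊆Γ))

-- Identifying formulas that are equal in every algebra would not do here: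
-- that relation lives in Set₁, while ISA._≈_ must be Set-valued.
infix 4 _≋_
data _≋_ : Fm → Fm → Set where
  refl′   : ∀ {φ} → φ ≋ φ
  sym′    : ∀ {φ ψ} → φ ≋ ψ → ψ ≋ φ
  trans′  : ∀ {φ ψ χ} → φ ≋ ψ → ψ ≋ χ → φ ≋ χ
  ⊓-cong  : ∀ {φ φ′ ψ ψ′} → φ ≋ φ′ → ψ ≋ ψ′ → (φ ∧ ψ) ≋ (φ′ ∧ ψ′)
  ⊔-cong  : ∀ {φ φ′ ψ ψ′} → φ ≋ φ′ → ψ ≋ ψ′ → (φ ∨ ψ) ≋ (φ′ ∨ ψ′)
  ¬-cong  : ∀ {φ φ′} → φ ≋ φ′ → ¬′ φ ≋ ¬′ φ′
  ∇-cong  : ∀ {φ φ′} → φ ≋ φ′ → ∇′ φ ≋ ∇′ φ′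
  ⊓-comm  : ∀ φ ψ → (φ ∧ ψ) ≋ (ψ ∧ φ)
  ⊔-comm  : ∀ φ ψ → (φ ∨ ψ) ≋ (ψ ∨ φ)
  ⊓-assoc : ∀ φ ψ χ → ((φ ∧ ψ) ∧ χ) ≋ (φ ∧ (ψ ∧ χ))
  ⊔-assoc : ∀ φ ψ χ → ((φ ∨ ψ) ∨ χ) ≋ (φ ∨ (ψ ∨ χ))
  ⊓-absorbs-⊔ : ∀ φ ψ → (φ ∧ (φ ∨ ψ)) ≋ φ
  ⊔-absorbs-⊓ : ∀ φ ψ → (φ ∨ (φ ∧ ψ)) ≋ φ
  ⊓-distrib-⊔ : ∀ φ ψ χ → (φ ∧ (ψ ∨ χ)) ≋ ((φ ∧ ψ) ∨ (φ ∧ χ))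
  ⊓-identity  : ∀ φ → (φ ∧ ⊤′) ≋ φ
  ⊔-identity  : ∀ φ → (φ ∨ ⊥′) ≋ φ
  ¬¬      : ∀ φ → ¬′ (¬′ φ) ≋ φ
  ¬-⊓     : ∀ φ ψ → ¬′ (φ ∧ ψ) ≋ (¬′ φ ∨ ¬′ ψ)
  ∇𝟘      : ∇′ ⊥′ ≋ ⊥′
  ∇-infl  : ∀ φ → (φ ∧ ∇′ φ) ≋ φ
  ∇-⊓     : ∀ φ ψ → ∇′ (φ ∧ ψ) ≋ (∇′ φ ∧ ∇′ ψ)
  ∇-compl : ∀ φ → (¬′ (∇′ φ) ∧ ∇′ φ) ≋ ⊥′

≋-sound : ∀ {φ ψ} → φ ≋ ψ → (A : ISA) (v : ℕ → ISA.Carrier A) →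
  ISA._≈_ A (⟦ A ⟧ φ v) (⟦ A ⟧ ψ v)
≋-sound refl′            A v = IsEquivalence.refl (ISA.isEquivalence A)
≋-sound (sym′ p)         A v = IsEquivalence.sym (ISA.isEquivalence A) (≋-sound p A v)
≋-sound (trans′ p q)     A v =
  IsEquivalence.trans (ISA.isEquivalence A) (≋-sound p A v) (≋-sound q A v)
≋-sound (⊓-cong p q)     A v = ISA.⊓-cong A (≋-sound p A v) (≋-sound q A v)
≋-sound (⊔-cong p q)     A v = ISA.⊔-cong A (≋-sound p A v) (≋-sound q A v)
≋-sound (¬-cong p)       A v = ISA.¬-cong A (≋-sound p A v)
≋-sound (∇-cong p)       A v = ISA.∇-cong A (≋-sound p A v)
≋-sound (⊓-comm _ _)     A v = ISA.⊓-comm A _ _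
≋-sound (⊔-comm _ _)     A v = ISA.⊔-comm A _ _
≋-sound (⊓-assoc _ _ _)  A v = ISA.⊓-assoc A _ _ _
≋-sound (⊔-assoc _ _ _)  A v = ISA.⊔-assoc A _ _ _
≋-sound (⊓-absorbs-⊔ _ _)   A v = ISA.⊓-absorbs-⊔ A _ _
≋-sound (⊔-absorbs-⊓ _ _)   A v = ISA.⊔-absorbs-⊓ A _ _
≋-sound (⊓-distrib-⊔ _ _ _) A v = ISA.⊓-distrib-⊔ A _ _ _
≋-sound (⊓-identity _)   A v = ISA.⊓-identity A _
≋-sound (⊔-identity _)   A v = ISA.⊔-identity A _
≋-sound (¬¬ _)           A v = ISA.¬¬ A _
≋-sound (¬-⊓ _ _)        A v = ISA.¬-⊓ A _ _
≋-sound ∇𝟘               A v = ISA.∇𝟘 A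
≋-sound (∇-infl _)       A v = ISA.∇-infl A _
≋-sound (∇-⊓ _ _)        A v = ISA.∇-⊓ A _ _
≋-sound (∇-compl _)      A v = ISA.∇-compl A _

lindenbaum : ISA
lindenbaum = record
  { Carrier = Fm ; _≈_ = _≋_
  ; isEquivalence = record { refl = refl′ ; sym = sym′ ; trans = trans′ }
  ; _⊓_ = _∧_ ; _⊔_ = _∨_ ; ¬_ = ¬′ ; ∇_ = ∇′ ; 𝟘 = ⊥′ ; 𝟙 = ⊤′
  ; ⊓-cong = ⊓-cong ; ⊔-cong = ⊔-cong ; ¬-cong = ¬-cong ; ∇-cong = ∇-cong
  ; ⊓-comm = ⊓-comm ; ⊔-comm = ⊔-comm ; ⊓-assoc = ⊓-assoc ; ⊔-assoc = ⊔-assoc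
  ; ⊓-absorbs-⊔ = ⊓-absorbs-⊔ ; ⊔-absorbs-⊓ = ⊔-absorbs-⊓
  ; ⊓-distrib-⊔ = ⊓-distrib-⊔ ; ⊓-identity = ⊓-identity ; ⊔-identity = ⊔-identity
  ; ¬¬ = ¬¬ ; ¬-⊓ = ¬-⊓ ; ∇𝟘 = ∇𝟘 ; ∇-infl = ∇-infl ; ∇-⊓ = ∇-⊓ ; ∇-compl = ∇-compl }

⟦⟧-var : ∀ φ → ⟦ lindenbaum ⟧ φ var ≡ φ
⟦⟧-var (var _) = refl
⟦⟧-var (φ ∧ ψ) = cong₂ _∧_ (⟦⟧-var φ) (⟦⟧-var ψ)
⟦⟧-var (φ ∨ ψ) = cong₂ _∨_ (⟦⟧-var φ) (⟦⟧-var ψ)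
⟦⟧-var (¬′ φ)  = cong ¬′ (⟦⟧-var φ)
⟦⟧-var (∇′ φ)  = cong ∇′ (⟦⟧-var φ)
⟦⟧-var ⊥′      = refl
⟦⟧-var ⊤′      = refl

lindenbaum≤⇒valid≤ : ∀ {φ ψ} → ISA._≤_ lindenbaum φ ψ → Valid≤ φ ψ
lindenbaum≤⇒valid≤ = ≋-sound

module GeneratedFilter (Γ : FmSet) where
  open ISA lindenbaum using (_≤_)
  open ISAProperties lindenbaum

  ⟨_⟩ : Fm → Set
  ⟨_⟩ φ = Σ (List Fm) λ Δ → All Γ Δ × ⋀ Δ ≤ φ

  ⋀-++ : ∀ Δ₁ Δ₂ → ⋀ (Δ₁ ++ Δ₂) ≋ (⋀ Δ₁ ∧ ⋀ Δ₂)
  ⋀-++ []       Δ₂ = sym′ (trans′ (⊓-comm _ _) (⊓-identity _))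
  ⋀-++ (γ ∷ Δ₁) Δ₂ = trans′ (⊓-cong refl′ (⋀-++ Δ₁ Δ₂)) (sym′ (⊓-assoc _ _ _))

  ⟨⟩-isLatticeFilter : IsLatticeFilter lindenbaum ⟨_⟩
  ⟨⟩-isLatticeFilter = record
    { has-𝟙 = [] , [] , x≤𝟙 ⊤′
    ; up    = λ { φ≤ψ (Δ , Δ⊆Γ , ⋀Δ≤φ) → Δ , Δ⊆Γ , ≤-trans ⋀Δ≤φ φ≤ψ }
    ; meet  = λ { (Δ₁ , Δ₁⊆Γ , ⋀Δ₁≤φ) (Δ₂ , Δ₂⊆Γ , ⋀Δ₂≤ψ) →
        Δ₁ ++ Δ₂ , ++⁺ Δ₁⊆Γ Δ₂⊆Γ ,
        ≤-trans (≤-reflexive (⋀-++ Δ₁ Δ₂)) (⊓-monotonic ⋀Δ₁≤φ ⋀Δ₂≤ψ) } }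

  Γ⊆⟨Γ⟩ : ∀ {γ} → Γ γ → ⟨ γ ⟩
  Γ⊆⟨Γ⟩ {γ} γ∈Γ = γ ∷ [] , γ∈Γ ∷ [] , x⊓y≤x γ ⊤′

  ⟨Γ⟩⊆six : ∀ {α} → ⟨ α ⟩ → Six Γ α
  ⟨Γ⟩⊆six {α} (Δ , Δ⊆Γ , ⋀Δ≤α) =
    Δ , Δ⊆Γ , Equivalence.from (sixFin⇔valid≤ Δ α) (lindenbaum≤⇒valid≤ ⋀Δ≤α)

matrix⇒six : ∀ Γ α → MatrixLogic Γ α → Six Γ α
matrix⇒six Γ α m = ⟨Γ⟩⊆six (subst ⟨_⟩ (⟦⟧-var α)
  (m lindenbaum ⟨_⟩ ⟨⟩-isLatticeFilter var
     (λ γ γ∈Γ → subst ⟨_⟩ (≡.sym (⟦⟧-var γ)) (Γ⊆⟨Γ⟩ γ∈Γ))))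
  where open GeneratedFilter Γ

six⇔matrix : ∀ Γ α → Six Γ α ⇔ MatrixLogic Γ α
six⇔matrix Γ α = mk⇔ (six⇒matrix Γ α) (matrix⇒six Γ α)

matrix⇔genMatrix : ∀ Γ α → MatrixLogic Γ α ⇔ GenMatrixLogic Γ α
matrix⇔genMatrix Γ α = mk⇔
  (λ m A v F isF → m A F isF v)
  (λ g A F isF v → g A v F isF)

mainTheorem8 : (Γ : FmSet) (α : Fm) →
    (Six Γ α ⇔ MatrixLogic Γ α) × (Six Γ α ⇔ GenMatrixLogic Γ α)
mainTheorem8 Γ α =
  six⇔matrix Γ α , ⇔.trans (six⇔matrix Γ α) (matrix⇔genMatrix Γ α)
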